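{- Let $L(0,n-1)$ be the path with nodes $0,\dots,n-1$ and edges $\{i,i+1\}$, with thresholds $t(0)=t(n-1)=1$ and $t(i)\in\{1,2\}$ for $1\le i\le n-2$. Let $0\le j<k\le n-1$ with $t(j)=t(k)=1$ and $t(j+1)=\dots=t(k-1)=2$. Let $\lambda\ge 1$ be arbitrary and let $p:V\to\{0,1,2\}$ be any incentive function with $p(i)\le t(i)$ and $\mathsf{Influenced}[p,\lambda]=V$. Then $$\sum_{i=j+1}^{k-1}p(i)\ \ge\ \begin{cases} k-j-2 & \text{if } j+1 \text{ is influenced by } j \text{ and } k-1 \text{ is influenced by } k,\\ k-j-1 & \text{if exactly one of these two happens},\\ k-j & \text{otherwise.}\end{cases}$$
   Context: The influence process on a graph $G=(V,E)$ with thresholds $t$ and incentive function $p$ is: $\mathsf{Influenced}[p,0]=\{v: p(v)=t(v)\}$ and, for $\ell>0$, $\mathsf{Influenced}[p,\ell]=\mathsf{Influenced}[p,\ell-1]\cup\{v : |N(v)\cap \mathsf{Influenced}[p,\ell-1]|\ge t(v)-p(v)\}$. A node $v$ is influenced at round $\ell>0$ if $v\in\mathsf{Influenced}[p,\ell]\setminus\mathsf{Influenced}[p,\ell-1]$ (and at round $0$ if $v\in\mathsf{Influenced}[p,0]$). A node $u$ is said to be influenced by its neighbour $w$ if $w$ is influenced at a round strictly earlier than the round at which $u$ is influenced (so that $w$ contributes to the influence received by $u$). -}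

module Defs where

open import Data.Nat.Base using (ℕ; zero; suc; _+_; _∸_; _<_; _<ᵇ_; _≤ᵇ_; _≡ᵇ_)
open import Data.Bool.Base using (Bool; true; false; _∧_; _∨_; if_then_else_)
open import Data.Product using (_×_; ∃-syntax)
open import Relation.Binary.PropositionalEquality using (_≡_)

-- Nodes of the path L(0,n-1) are the naturals 0,…,n-1; edges {i,i+1}.
-- Thresholds t and incentives p are functions ℕ → ℕ (only values on 0..n-1 matter).

b2n : Bool → ℕ
b2n true  = 1
b2n false = 0

-- |N(v) ∩ S| for the path on nodes 0..n-1 (neighbours v-1 if v ≥ 1, v+1 if v+1 < n)
nbrCount : ℕ → (ℕ → Bool) → ℕ → ℕ
nbrCount n S zero    = b2n ((1 <ᵇ n) ∧ S 1)
nbrCount n S (suc v) = b2n (S v) + b2n ((suc (suc v) <ᵇ n) ∧ S (suc (suc v)))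

Influenced : (n : ℕ) (t p : ℕ → ℕ) → ℕ → ℕ → Bool
Influenced n t p zero    v = p v ≡ᵇ t v
Influenced n t p (suc ℓ) v =
  Influenced n t p ℓ v ∨ (t v ∸ p v ≤ᵇ nbrCount n (Influenced n t p ℓ) v)

InfluencedAtRound : (n : ℕ) (t p : ℕ → ℕ) → ℕ → ℕ → Set
InfluencedAtRound n t p zero    v = Influenced n t p zero v ≡ true
InfluencedAtRound n t p (suc ℓ) v =
  (Influenced n t p (suc ℓ) v ≡ true) × (Influenced n t p ℓ v ≡ false)

InfluencedBy : (n : ℕ) (t p : ℕ → ℕ) → ℕ → ℕ → Set
InfluencedBy n t p u w =
  ∃[ ℓw ] ∃[ ℓu ] (InfluencedAtRound n t p ℓw w × InfluencedAtRound n t p ℓu u × ℓw < ℓu)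

sumFrom : (ℕ → ℕ) → ℕ → ℕ → ℕ
sumFrom f a zero    = 0
sumFrom f a (suc m) = f a + sumFrom f (suc a) m

-- Let r(v) be the round at which v is influenced. If r(v) = 0 then p(v) = t(v);
-- otherwise at least t(v) − p(v) neighbours of v were influenced before round r(v).
-- So every node v of threshold 2 has p(v) + #{neighbours u : r(u) < r(v)} ≥ 2.
-- Summing this over the m = k − j − 1 nodes strictly between j and k counts each of
-- the m − 1 inner edges at most once, and the two boundary edges exactly when j+1
-- is influenced by j, resp. k−1 by k; hence Σ p ≥ m + 1 − (number of those events).
module Submission where

open import Defs
open import Data.Nat.Base using (ℕ; zero; suc; _+_; _∸_; _<_; _≤_)
open import Data.Bool.Base using (true)
open import Data.Product using (_×_)
open import Data.Sum using (_⊎_)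
open import Relation.Nullary using (¬_)
open import Relation.Binary.PropositionalEquality using (_≡_)

open import Data.Nat.Base using (z≤n; s≤s; s≤s⁻¹; _<ᵇ_; _≤ᵇ_)
open import Data.Nat.Properties
open import Data.Nat.Tactic.RingSolver using (solve-∀)
open import Data.Bool.Base using (Bool; false; _∧_; _∨_; if_then_else_)
open import Data.Bool.Properties using (T-≡)
open import Data.Product using (_,_; ∃-syntax)
open import Data.Sum using ([_,_])
open import Data.Empty using (⊥-elim)
open import Function using (_∘_)
open import Function.Bundles using (Equivalence)
open import Relation.Binary.PropositionalEquality using (refl; sym; trans; cong; subst)

b2n≤1 : ∀ b → b2n b ≤ 1
b2n≤1 true  = ≤-refl
b2n≤1 false = z≤n

b2n-∧ : ∀ a b → b2n (a ∧ b) ≤ b2n b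
b2n-∧ true  b = ≤-refl
b2n-∧ false b = z≤n

m≤n∸1⇒m<n : ∀ {i m} n → i < m → m ≤ n ∸ 1 → m < n
m≤n∸1⇒m<n zero    (s≤s _) ()
m≤n∸1⇒m<n (suc n) _       m≤n = s≤s m≤n

suc[m]<n⇒∃[o]n≡2+o+m : ∀ {m n} → suc m < n → ∃[ o ] n ≡ 2 + o + m
suc[m]<n⇒∃[o]n≡2+o+m {m} lt =
  let o , eq = m≤n⇒∃[o]m+o≡n lt in o , trans (sym eq) (cong (suc ∘ suc) (+-comm m o))

-- The least ℓ ≤ b with f ℓ ≡ true, or b if there is none.
least : (ℕ → Bool) → ℕ → ℕ
least f zero    = zero
least f (suc b) = if f zero then zero else suc (least (f ∘ suc) b)

least-true : ∀ (f : ℕ → Bool) b → f b ≡ true → f (least f b) ≡ true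
least-true f zero    h = h
least-true f (suc b) h with f zero in eq
... | true  = eq
... | false = least-true (f ∘ suc) b h

least-minimal : ∀ (f : ℕ → Bool) b {ℓ} → f ℓ ≡ true → least f b ≤ ℓ
least-minimal f zero            h = z≤n
least-minimal f (suc b)         h with f zero in eq
... | true = z≤n
least-minimal f (suc b) {zero}  h | false with () ← trans (sym eq) h
least-minimal f (suc b) {suc ℓ} h | false = s≤s (least-minimal (f ∘ suc) b h)

least-below : ∀ (f : ℕ → Bool) b {ℓ} → ℓ < least f b → f ℓ ≡ false
least-below f b {ℓ} lt with f ℓ in eq
... | false = refl
... | true  = ⊥-elim (<⇒≱ lt (least-minimal f b eq))

-- The m + 1 node hypotheses sum to 2(m + 1); each of the m inner edges occurs in
-- the hypotheses of both its endpoints but contributes at most 1, by E-asym.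
path-bound : (w : ℕ → ℕ) (E : ℕ → ℕ → ℕ) → (∀ u v → E u v + E v u ≤ 1) → ∀ m j →
  (∀ x → j ≤ x → x ≤ m + j → 2 ≤ w (suc x) + (E x (suc x) + E (2 + x) (suc x))) →
  2 + m ≤ sumFrom w (suc j) (suc m) + (E j (suc j) + E (2 + m + j) (suc m + j))
path-bound w E E-asym zero j local =
  subst (2 ≤_) (cong (_+ _) (sym (+-identityʳ (w (suc j))))) (local j ≤-refl ≤-refl)
path-bound w E E-asym (suc m) j local = s≤s⁻¹ (begin
  2 + (2 + m)                   ≤⟨ +-mono-≤ (local j ≤-refl (m≤n+m j (suc m))) IH ⟩
  (P + (a + c)) + (S + (d + b)) ≡⟨ regroup P a c S d b ⟩
  (P + S) + (a + b) + (c + d)   ≤⟨ +-monoʳ-≤ ((P + S) + (a + b)) (E-asym (2 + j) (suc j)) ⟩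
  (P + S) + (a + b) + 1         ≡⟨ +-comm ((P + S) + (a + b)) 1 ⟩
  suc ((P + S) + (a + b))       ∎)
  where
    open ≤-Reasoning
    P = w (suc j)
    S = sumFrom w (2 + j) (suc m)
    a = E j (suc j)
    b = E (3 + m + j) (2 + m + j)
    c = E (2 + j) (suc j)
    d = E (suc j) (2 + j)
    regroup : ∀ P a c S d b → (P + (a + c)) + (S + (d + b)) ≡ (P + S) + (a + b) + (c + d)
    regroup = solve-∀
    IH : 2 + m ≤ S + (d + b)
    IH = subst (λ i → 2 + m ≤ S + (d + E (2 + i) (suc i))) (+-suc m j)
           (path-bound w E E-asym m (suc j) λ x j<x x≤m+1+j →
              local x (≤-trans (n≤1+n j) j<x) (subst (x ≤_) (+-suc m j) x≤m+1+j))

first-influenced⇒influencedAtRound : ∀ {n t p v} r → Influenced n t p r v ≡ true →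
  (∀ {ℓ} → ℓ < r → Influenced n t p ℓ v ≡ false) → InfluencedAtRound n t p r v
first-influenced⇒influencedAtRound zero    h _     = h
first-influenced⇒influencedAtRound (suc r) h below = h , below ≤-refl

module Rounds (n : ℕ) (t p : ℕ → ℕ) (λ′ : ℕ) where

  round : ℕ → ℕ
  round v = least (λ ℓ → Influenced n t p ℓ v) λ′

  earlier : ℕ → ℕ → ℕ
  earlier u v = b2n (round u <ᵇ round v)

  influencedAtRound-round : ∀ {v} → Influenced n t p λ′ v ≡ true →
    InfluencedAtRound n t p (round v) v
  influencedAtRound-round {v} h =
    first-influenced⇒influencedAtRound (round v) (least-true f λ′ h) (least-below f λ′)
    where f = λ ℓ → Influenced n t p ℓ v

  earlier≤1 : ∀ u v → earlier u v ≤ 1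
  earlier≤1 u v = b2n≤1 (round u <ᵇ round v)

  earlier-asym : ∀ u v → earlier u v + earlier v u ≤ 1
  earlier-asym u v with round u <ᵇ round v in uv | round v <ᵇ round u in vu
  ... | false | false = z≤n
  ... | false | true  = ≤-refl
  ... | true  | false = ≤-refl
  ... | true  | true  = ⊥-elim (<-asym (<ᵇ⇒< (round u) (round v) (Equivalence.from T-≡ uv))
                                      (<ᵇ⇒< (round v) (round u) (Equivalence.from T-≡ vu)))

  ¬influencedBy⇒earlier≡0 : ∀ {u v} → Influenced n t p λ′ u ≡ true →
    Influenced n t p λ′ v ≡ true → ¬ InfluencedBy n t p v u → earlier u v ≡ 0
  ¬influencedBy⇒earlier≡0 {u} {v} hu hv ¬uv with round u <ᵇ round v in lt
  ... | false = refl
  ... | true  = ⊥-elim (¬uv (round u , round v , influencedAtRound-round hu ,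
                             influencedAtRound-round hv ,
                             <ᵇ⇒< (round u) (round v) (Equivalence.from T-≡ lt)))

  influenced⇒earlier : ∀ w {ℓ} → b2n (Influenced n t p ℓ w) ≤ b2n (round w <ᵇ suc ℓ)
  influenced⇒earlier w {ℓ} with Influenced n t p ℓ w in eq
  ... | false = z≤n
  ... | true = ≤-reflexive (cong b2n (sym (Equivalence.to T-≡
                 (<⇒<ᵇ (s≤s (least-minimal (λ ℓ → Influenced n t p ℓ w) λ′ eq))))))

  threshold-met-at : ∀ x r → InfluencedAtRound n t p r (suc x) →
    t (suc x) ≤ p (suc x) + (b2n (round x <ᵇ r) + b2n (round (2 + x) <ᵇ r))
  threshold-met-at x zero h =
    ≤-trans (≤-reflexive (sym (≡ᵇ⇒≡ (p (suc x)) (t (suc x)) (Equivalence.from T-≡ h))))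
            (m≤m+n (p (suc x)) (b2n (round x <ᵇ 0) + b2n (round (2 + x) <ᵇ 0)))
  threshold-met-at x (suc ℓ) (h , not-yet) = begin
    t v                                     ≤⟨ m≤n+m∸n (t v) (p v) ⟩
    p v + (t v ∸ p v)                       ≤⟨ +-monoʳ-≤ (p v) (≤ᵇ⇒≤ _ _ (Equivalence.from T-≡ fires)) ⟩
    p v + nbrCount n (Influenced n t p ℓ) v ≤⟨ +-monoʳ-≤ (p v) (+-mono-≤ (influenced⇒earlier x)
                                                 (≤-trans (b2n-∧ _ _) (influenced⇒earlier (2 + x)))) ⟩
    p v + (b2n (round x <ᵇ suc ℓ) + b2n (round (2 + x) <ᵇ suc ℓ)) ∎
    where
      open ≤-Reasoning
      v = suc x
      fires : (t v ∸ p v ≤ᵇ nbrCount n (Influenced n t p ℓ) v) ≡ true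
      fires = trans (sym (cong (_∨ (t v ∸ p v ≤ᵇ nbrCount n (Influenced n t p ℓ) v)) not-yet)) h

  threshold-met : ∀ x → Influenced n t p λ′ (suc x) ≡ true →
    t (suc x) ≤ p (suc x) + (earlier x (suc x) + earlier (2 + x) (suc x))
  threshold-met x h = threshold-met-at x (round (suc x)) (influencedAtRound-round h)

lemma1 : (n : ℕ) (t p : ℕ → ℕ) (j k λ′ : ℕ) →
    t 0 ≡ 1 → t (n ∸ 1) ≡ 1 →
    (∀ i → 1 ≤ i → i ≤ n ∸ 2 → (t i ≡ 1) ⊎ (t i ≡ 2)) →
    j < k → k ≤ n ∸ 1 → suc j < k →
    t j ≡ 1 → t k ≡ 1 →
    (∀ i → j < i → i < k → t i ≡ 2) →
    1 ≤ λ′ →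
    (∀ i → i < n → p i ≤ 2) →
    (∀ i → i < n → p i ≤ t i) →
    (∀ v → v < n → Influenced n t p λ′ v ≡ true) →
    let A = InfluencedBy n t p (suc j) j
        B = InfluencedBy n t p (k ∸ 1) k
        S = sumFrom p (suc j) (k ∸ j ∸ 1)
    in ((A × B) → k ∸ j ∸ 2 ≤ S)
     × (((A × ¬ B) ⊎ (¬ A × B)) → k ∸ j ∸ 1 ≤ S)
     × ((¬ A × ¬ B) → k ∸ j ≤ S)
lemma1 n t p j k λ′ _ _ _ j<k k≤n∸1 j+1<k _ _ t≡2 _ _ _ influenced
  with m , refl ← suc[m]<n⇒∃[o]n≡2+o+m j+1<k
  rewrite m+n∸n≡m (2 + m) j
  = (λ _ → bound (+-mono-≤ (earlier≤1 j (suc j)) (earlier≤1 k′ (suc m + j))))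
  , [ (λ (_ , ¬B) → bound (+-mono-≤ (earlier≤1 j (suc j)) (≤-reflexive (right≡0 ¬B))))
    , (λ (¬A , _) → bound (+-mono-≤ (≤-reflexive (left≡0 ¬A)) (earlier≤1 k′ (suc m + j)))) ]
  , (λ (¬A , ¬B) → bound (+-mono-≤ (≤-reflexive (left≡0 ¬A)) (≤-reflexive (right≡0 ¬B))))
  where
    open Rounds n t p λ′
    k′ S e : ℕ
    k′ = 2 + m + j
    S = sumFrom p (suc j) (suc m)
    e = earlier j (suc j) + earlier k′ (suc m + j)
    k<n : k′ < n
    k<n = m≤n∸1⇒m<n n j<k k≤n∸1
    left≡0 : ¬ InfluencedBy n t p (suc j) j → earlier j (suc j) ≡ 0
    left≡0 = ¬influencedBy⇒earlier≡0 (influenced j (<-trans j<k k<n))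
                                     (influenced (suc j) (<-trans j+1<k k<n))
    right≡0 : ¬ InfluencedBy n t p (suc m + j) k′ → earlier k′ (suc m + j) ≡ 0
    right≡0 = ¬influencedBy⇒earlier≡0 (influenced k′ k<n) (influenced (suc m + j) (<-trans ≤-refl k<n))
    node-bound : ∀ x → j ≤ x → x ≤ m + j →
      2 ≤ p (suc x) + (earlier x (suc x) + earlier (2 + x) (suc x))
    node-bound x j≤x x≤m+j =
      ≤-trans (≤-reflexive (sym (t≡2 (suc x) (s≤s j≤x) (s≤s (s≤s x≤m+j)))))
              (threshold-met x (influenced (suc x) (<-trans (s≤s (s≤s x≤m+j)) k<n)))
    bound : ∀ {c} → e ≤ c → 2 + m ∸ c ≤ S
    bound e≤c = ≤-trans (∸-monoʳ-≤ (2 + m) e≤c) (m≤n+o⇒m∸n≤o (2 + m) e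
      (≤-trans (path-bound p earlier earlier-asym m j node-bound) (≤-reflexive (+-comm S e))))
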